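{- Let $K$ be a field of characteristic $0$. Let $M'$ be an $m\times(n'+1)$ multiplicity matrix that is not the multiplicity matrix of a polynomial in $K[x]$. Let $\ell\ge0$ and $n=n'+\ell$. If $M$ is an $m\times(n+1)$ multiplicity matrix whose $\ell$-truncation is $M'$, then $M$ is not the multiplicity matrix of a polynomial in $K[x]$.
   Context: For a polynomial $f$ of degree $d$ and a sequence $\Lambda=(\lambda_1,\ldots,\lambda_m)$ of distinct elements of $K$, the multiplicity matrix $M_f(\Lambda)$ is the $m\times(d+1)$ matrix (rows $i\in\{1,\ldots,m\}$, columns $j\in\{0,\ldots,d\}$) whose $(i,j)$ entry is the multiplicity of $\lambda_i$ as a zero of $f^{(j)}(x)$ (which is $0$ if $f^{(j)}(\lambda_i)\neq0$). A matrix $M$ is the multiplicity matrix of a polynomial if there exist a polynomial $f\in K[x]$ and a sequence $\Lambda$ of distinct elements of $K$ with $M=M_f(\Lambda)$. An $m\times(n+1)$ multiplicity matrix is a matrix $(\mu_{i,j})$ of nonnegative integers (columns $j=0,\ldots,n$) such that each row satisfies $\mu_{i,n}=0$ and $\mu_{i,j}\ge1\Rightarrow\mu_{i,j+1}=\mu_{i,j}-1$, and $\sum_{i=1}^m\mu_{i,j}\le n-j$ for all $j$. The $\ell$-truncation of an $m\times(n+1)$ matrix is the $m\times(n+1-\ell)$ submatrix obtained by deleting its first $\ell$ columns. -}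

module Defs where

open import Level using (Level; _⊔_)
open import Algebra.Bundles using (CommutativeRing)
open import Data.Nat using (ℕ; zero; suc; _∸_; _≤_) renaming (_+_ to _+ℕ_)
open import Data.Fin using (Fin; toℕ; fromℕ; inject₁) renaming (suc to fsuc; zero to fzero)
open import Data.List using (List; []; _∷_; _∷ʳ_; length)
open import Data.Product using (Σ; ∃; _×_; _,_)
open import Data.Unit using (⊤)
open import Relation.Nullary using (¬_)
open import Relation.Binary.PropositionalEquality using (_≡_)

record Field (c ℓ : Level) : Set (Level.suc (c ⊔ ℓ)) where
  field
    commutativeRing : CommutativeRing c ℓ
  open CommutativeRing commutativeRing public
  field
    0≉1     : ¬ (0# ≈ 1#)
    inverse : ∀ x → ¬ (x ≈ 0#) → Σ Carrier λ y → (x * y) ≈ 1#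

module FieldDefs {c ℓ} (K : Field c ℓ) where
  open Field K

  natK : ℕ → Carrier
  natK zero    = 0#
  natK (suc n) = 1# + natK n

  CharZero : Set ℓ
  CharZero = ∀ n → ¬ (natK (suc n) ≈ 0#)

  -- Polynomials in K[x] as coefficient lists a₀ ∷ a₁ ∷ ... (lowest first),
  -- identified up to trailing zeros.

  Poly : Set c
  Poly = List Carrier

  infix 4 _≈ₚ_
  _≈ₚ_ : Poly → Poly → Set ℓ
  []       ≈ₚ []       = Level.Lift ℓ ⊤
  []       ≈ₚ (b ∷ bs) = (b ≈ 0#) × ([] ≈ₚ bs)
  (a ∷ as) ≈ₚ []       = (a ≈ 0#) × (as ≈ₚ [])
  (a ∷ as) ≈ₚ (b ∷ bs) = (a ≈ b) × (as ≈ₚ bs)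

  infixl 6 _+ₚ_
  _+ₚ_ : Poly → Poly → Poly
  []       +ₚ q        = q
  (a ∷ p)  +ₚ []       = a ∷ p
  (a ∷ p)  +ₚ (b ∷ q)  = (a + b) ∷ (p +ₚ q)

  scale : Carrier → Poly → Poly
  scale a []      = []
  scale a (b ∷ q) = (a * b) ∷ scale a q

  infixl 7 _*ₚ_
  _*ₚ_ : Poly → Poly → Poly
  []      *ₚ q = []
  (a ∷ p) *ₚ q = scale a q +ₚ (0# ∷ (p *ₚ q))

  _^ₚ_ : Poly → ℕ → Poly
  p ^ₚ zero  = 1# ∷ []
  p ^ₚ suc k = p *ₚ (p ^ₚ k)

  X-_ : Carrier → Poly
  X- a = (- a) ∷ 1# ∷ []

  _∣ₚ_ : Poly → Poly → Set (c ⊔ ℓ)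
  p ∣ₚ f = Σ Poly λ g → f ≈ₚ p *ₚ g

  HasDegree : Poly → ℕ → Set (c ⊔ ℓ)
  HasDegree f d = Σ Poly λ cs → Σ Carrier λ a →
    (f ≡ cs ∷ʳ a) × (length cs ≡ d) × ¬ (a ≈ 0#)

  derivFrom : ℕ → Poly → Poly
  derivFrom k []      = []
  derivFrom k (b ∷ q) = (natK k * b) ∷ derivFrom (suc k) q

  deriv : Poly → Poly
  deriv []      = []
  deriv (a ∷ q) = derivFrom 1 q

  deriv^ : ℕ → Poly → Poly
  deriv^ zero    f = f
  deriv^ (suc j) f = deriv (deriv^ j f)

  Multiplicity : Poly → Carrier → ℕ → Set (c ⊔ ℓ)
  Multiplicity f a k = (((X- a) ^ₚ k) ∣ₚ f) × ¬ (((X- a) ^ₚ suc k) ∣ₚ f)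

  Distinct : ∀ {m} → (Fin m → Carrier) → Set ℓ
  Distinct Λ = ∀ i j → Λ i ≈ Λ j → i ≡ j

  IsPolyMultMatrix : ∀ {m n} → (Fin m → Fin (suc n) → ℕ) → Set (c ⊔ ℓ)
  IsPolyMultMatrix {m} {n} M =
    Σ Poly λ f → Σ (Fin m → Carrier) λ Λ →
      HasDegree f n × Distinct Λ ×
      (∀ i j → Multiplicity (deriv^ (toℕ j) f) (Λ i) (M i j))

sumFin : ∀ {m} → (Fin m → ℕ) → ℕ
sumFin {zero}  f = 0
sumFin {suc m} f = f fzero +ℕ sumFin (λ i → f (fsuc i))

IsMultMatrix : ∀ {m n} → (Fin m → Fin (suc n) → ℕ) → Set
IsMultMatrix {m} {n} M =
  (∀ i → M i (fromℕ n) ≡ 0) ×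
  (∀ i (j : Fin n) → 1 ≤ M i (inject₁ j) → M i (fsuc j) ≡ M i (inject₁ j) ∸ 1) ×
  (∀ (j : Fin (suc n)) → sumFin (λ i → M i j) ≤ n ∸ toℕ j)

IsTruncation : ∀ {m n n'} (ℓ : ℕ) → (Fin m → Fin (suc n) → ℕ) →
  (Fin m → Fin (suc n') → ℕ) → Set
IsTruncation ℓ M M' =
  ∀ i j j' → toℕ j ≡ ℓ +ℕ toℕ j' → M i j ≡ M' i j'

{-# OPTIONS --safe #-}
module Submission where

open import Defs
open import Data.Nat using (ℕ; zero; suc; _+_)
open import Data.Nat.Properties using (+-identityʳ; +-suc; +-comm; suc-injective)
open import Data.Fin using (Fin; toℕ; cast; _↑ʳ_)
open import Data.Fin.Properties using (toℕ-cast; toℕ-↑ʳ)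
open import Data.List using ([]; _∷_; _∷ʳ_; length)
open import Data.Product using (_,_)
open import Relation.Nullary using (¬_)
open import Relation.Binary.PropositionalEquality
  using (_≡_; refl; sym; trans; cong; subst; subst₂; module ≡-Reasoning)
import Relation.Binary.Reasoning.Setoid as SetoidReasoning

-- If f has degree n' + ℓ and realises M at Λ, then f^(ℓ) has degree n'
-- (characteristic 0 keeps its leading coefficient nonzero) and, since
-- (f^(ℓ))^(j') = f^(ℓ + j'), it realises the ℓ-truncation M' at the same Λ.
-- Neither matrix needs to satisfy the axioms of a multiplicity matrix.

module _ {c ℓ₀} (K : Field c ℓ₀) where
  open Field K
    using (_≈_; _*_; 0#; 1#; setoid; inverse; *-comm; *-assoc; *-identityˡ; *-congˡ; *-congʳ; zeroʳ)
    renaming (sym to ≈-sym; trans to ≈-trans)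
  open FieldDefs K

  x≉0∧y≉0⇒xy≉0 : ∀ {x y} → ¬ (x ≈ 0#) → ¬ (y ≈ 0#) → ¬ (x * y ≈ 0#)
  x≉0∧y≉0⇒xy≉0 {x} {y} x≉0 y≉0 xy≈0 with inverse x x≉0
  ... | x⁻¹ , xx⁻¹≈1 = y≉0 (begin
    y               ≈⟨ ≈-sym (*-identityˡ y) ⟩
    1# * y          ≈⟨ *-congʳ (≈-trans (≈-sym xx⁻¹≈1) (*-comm x x⁻¹)) ⟩
    (x⁻¹ * x) * y   ≈⟨ *-assoc x⁻¹ x y ⟩
    x⁻¹ * (x * y)   ≈⟨ *-congˡ xy≈0 ⟩
    x⁻¹ * 0#        ≈⟨ zeroʳ x⁻¹ ⟩
    0#              ∎)
    where open SetoidReasoning setoid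

  derivFrom-∷ʳ : ∀ k cs a →
    derivFrom k (cs ∷ʳ a) ≡ derivFrom k cs ∷ʳ (natK (k + length cs) * a)
  derivFrom-∷ʳ k []       a = cong (λ t → (natK t * a) ∷ []) (sym (+-identityʳ k))
  derivFrom-∷ʳ k (b ∷ cs) a = cong ((natK k * b) ∷_) (begin
    derivFrom (suc k) (cs ∷ʳ a)
      ≡⟨ derivFrom-∷ʳ (suc k) cs a ⟩
    derivFrom (suc k) cs ∷ʳ (natK (suc k + length cs) * a)
      ≡⟨ cong (λ t → derivFrom (suc k) cs ∷ʳ (natK t * a)) (sym (+-suc k (length cs))) ⟩
    derivFrom (suc k) cs ∷ʳ (natK (k + suc (length cs)) * a) ∎)
    where open ≡-Reasoning

  length-derivFrom : ∀ k cs → length (derivFrom k cs) ≡ length cs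
  length-derivFrom k []       = refl
  length-derivFrom k (b ∷ cs) = cong suc (length-derivFrom (suc k) cs)

  deriv-HasDegree : CharZero → ∀ f d → HasDegree f (suc d) → HasDegree (deriv f) d
  deriv-HasDegree char0 .((c₀ ∷ cs) ∷ʳ a) d (c₀ ∷ cs , a , refl , len≡ , a≉0) =
    derivFrom 1 cs , natK (suc (length cs)) * a , derivFrom-∷ʳ 1 cs a ,
    trans (length-derivFrom 1 cs) (suc-injective len≡) ,
    x≉0∧y≉0⇒xy≉0 (char0 (length cs)) a≉0

  deriv^-HasDegree : CharZero → ∀ ℓ f d → HasDegree f (d + ℓ) → HasDegree (deriv^ ℓ f) d
  deriv^-HasDegree char0 zero    f d deg = subst (HasDegree f) (+-identityʳ d) deg
  deriv^-HasDegree char0 (suc ℓ) f d deg =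
    deriv-HasDegree char0 (deriv^ ℓ f) d
      (deriv^-HasDegree char0 ℓ f (suc d) (subst (HasDegree f) (+-suc d ℓ) deg))

  deriv^-+ : ∀ j ℓ f → deriv^ (j + ℓ) f ≡ deriv^ j (deriv^ ℓ f)
  deriv^-+ zero    ℓ f = refl
  deriv^-+ (suc j) ℓ f = cong deriv (deriv^-+ j ℓ f)

  shiftColumn : ∀ {n'} ℓ → Fin (suc n') → Fin (suc (n' + ℓ))
  shiftColumn {n'} ℓ j' = cast (trans (+-suc ℓ n') (cong suc (+-comm ℓ n'))) (ℓ ↑ʳ j')

  toℕ-shiftColumn : ∀ {n'} ℓ (j' : Fin (suc n')) → toℕ (shiftColumn ℓ j') ≡ ℓ + toℕ j'
  toℕ-shiftColumn ℓ j' = trans (toℕ-cast _ (ℓ ↑ʳ j')) (toℕ-↑ʳ ℓ j')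

  IsPolyMultMatrix-truncation : CharZero → ∀ {m n' ℓ}
    {M : Fin m → Fin (suc (n' + ℓ)) → ℕ} {M' : Fin m → Fin (suc n') → ℕ} →
    IsTruncation ℓ M M' → IsPolyMultMatrix M → IsPolyMultMatrix M'
  IsPolyMultMatrix-truncation char0 {n' = n'} {ℓ} {M} {M'} trunc
    (f , Λ , deg , distinct , mult) =
    deriv^ ℓ f , Λ , deriv^-HasDegree char0 ℓ f n' deg , distinct , mult'
    where
      mult' : ∀ i j' → Multiplicity (deriv^ (toℕ j') (deriv^ ℓ f)) (Λ i) (M' i j')
      mult' i j' = subst₂ (λ g k → Multiplicity g (Λ i) k) f⁽ʲ⁾≡ M≡M' (mult i j)
        where
          j : Fin (suc (n' + ℓ))
          j = shiftColumn ℓ j'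
          M≡M' : M i j ≡ M' i j'
          M≡M' = trunc i j j' (toℕ-shiftColumn ℓ j')
          f⁽ʲ⁾≡ : deriv^ (toℕ j) f ≡ deriv^ (toℕ j') (deriv^ ℓ f)
          f⁽ʲ⁾≡ = trans (cong (λ t → deriv^ t f)
                           (trans (toℕ-shiftColumn ℓ j') (+-comm ℓ (toℕ j'))))
                        (deriv^-+ (toℕ j') ℓ f)

theorem7 : ∀ {c ℓ₀} (K : Field c ℓ₀) → FieldDefs.CharZero K →
    (m n' ℓ : ℕ) (M' : Fin m → Fin (suc n') → ℕ) →
    IsMultMatrix M' → ¬ FieldDefs.IsPolyMultMatrix K M' →
    (M : Fin m → Fin (suc (n' + ℓ)) → ℕ) →
    IsMultMatrix M → IsTruncation ℓ M M' →
    ¬ FieldDefs.IsPolyMultMatrix K M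
theorem7 K char0 m n' ℓ M' _ M'-notPoly M _ trunc M-poly =
  M'-notPoly (IsPolyMultMatrix-truncation K char0 trunc M-poly)
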